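{- Let $k\ge 3$ be an odd integer and $n$ an integer, let $m>k$, and let $H$ be a dragon tail of length $m$ with first blue edge $u_0u_1$. Then Builder can play so that after fewer than $\log_2 m+8$ rounds of the game $\tilde R_H(C_k,C_n)$ the host graph contains a red $C_k$ or a blue cycle whose vertex set consists of more than $m-k$ but at most $m+1$ vertices of the dragon tail and which contains the edge $u_0u_1$.
   Context: Online Ramsey game: Builder and Painter play on the infinite complete graph $K_{\mathbb N}$. For a colored graph $H$ (each edge red or blue), the game $\tilde R_H(G_1,G_2)$ starts with a copy of $H$ already drawn and colored on the board; in each round Builder selects a previously unselected edge and Painter colors it red or blue; the game ends as soon as the graph of all colored edges (the host graph) contains a red copy of $G_1$ or a blue copy of $G_2$. $C_k$ is the cycle on $k$ vertices. A dragon tail $\mathcal T(m)$ of length $m$ is the colored graph consisting of a red path $u_0w_1u_1w_2u_2\dots w_m u_m$ of length $2m$ together with the blue path $u_0u_1\dots u_m$; its first blue edge is $u_0u_1$. -}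

module Defs where

open import Data.Nat using (ℕ; zero; suc; _+_; _*_; _∸_; _^_; _≤_; _<_; _%_)
open import Data.Product using (Σ; ∃; _×_; _,_)
open import Data.Sum using (_⊎_)
open import Data.List using (List; []; _∷_)
open import Data.List.Membership.Propositional using (_∈_)
open import Relation.Binary.PropositionalEquality using (_≡_; _≢_)
open import Relation.Nullary using (¬_)

Odd : ℕ → Set
Odd k = k % 2 ≡ 1

data Color : Set where
  red blue : Color

SameEdge : ℕ → ℕ → ℕ → ℕ → Set
SameEdge a b x y = (a ≡ x × b ≡ y) ⊎ (a ≡ y × b ≡ x)

-- The dragon tail T(m), embedded in K_ℕ.
-- emb : ℕ → ℕ is injective on positions 0 … 2m; position 2i is u_i
-- (0 ≤ i ≤ m) and position 2i-1 is w_i (1 ≤ i ≤ m).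

InjectiveBelow : ℕ → (ℕ → ℕ) → Set
InjectiveBelow N f = ∀ i j → i < N → j < N → f i ≡ f j → i ≡ j

module Tail (emb : ℕ → ℕ) (m : ℕ) where
  u : ℕ → ℕ
  u i = emb (2 * i)

  w : ℕ → ℕ
  w i = emb (2 * i ∸ 1)

  InTail : ℕ → Set
  InTail x = Σ ℕ λ p → p ≤ 2 * m × emb p ≡ x

  TailEdge : Color → ℕ → ℕ → Set
  TailEdge red  x y = Σ ℕ λ i → 1 ≤ i × i ≤ m ×
                        (SameEdge (u (i ∸ 1)) (w i) x y ⊎ SameEdge (w i) (u i) x y)
  TailEdge blue x y = Σ ℕ λ i → i < m × SameEdge (u i) (u (suc i)) x y

-- The game.  A move is a selected edge together with Painter's colour.
-- A history lists the moves made so far (most recent first).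

Edge : Set
Edge = ℕ × ℕ

Move : Set
Move = Edge × Color

History : Set
History = List Move

BuilderStrategy : Set
BuilderStrategy = History → Edge

PainterStrategy : Set
PainterStrategy = History → Edge → Color

play : BuilderStrategy → PainterStrategy → ℕ → History
play β π zero    = []
play β π (suc r) = let h = play β π r in (β h , π h (β h)) ∷ h

module Host (emb : ℕ → ℕ) (m : ℕ) where
  open Tail emb m

  HostEdge : History → Color → ℕ → ℕ → Set
  HostEdge h c x y = TailEdge c x y ⊎ (((x , y) , c) ∈ h) ⊎ (((y , x) , c) ∈ h)

  Legal : History → Edge → Set
  Legal h (x , y) = x ≢ y × ((c : Color) → ¬ HostEdge h c x y)

record Cycle (E : ℕ → ℕ → Set) (ℓ : ℕ) : Set where
  field
    v      : ℕ → ℕ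
    len≥3  : 3 ≤ ℓ
    inj    : InjectiveBelow ℓ v
    path   : ∀ i → suc i < ℓ → E (v i) (v (suc i))
    close  : E (v (ℓ ∸ 1)) (v 0)

  AllVertices : (ℕ → Set) → Set
  AllVertices P = ∀ i → i < ℓ → P (v i)

  HasEdge : ℕ → ℕ → Set
  HasEdge a b = (Σ ℕ λ i → suc i < ℓ × SameEdge a b (v i) (v (suc i)))
                ⊎ SameEdge a b (v (ℓ ∸ 1)) (v 0)

-- r < log₂ m + 8  (over the reals), equivalently 2^r < 2^8 · m
FewerThanLog2Plus8 : ℕ → ℕ → Set
FewerThanLog2Plus8 m r = 2 ^ r < 256 * m

module Goal (emb : ℕ → ℕ) (m k : ℕ) where
  open Tail emb m
  open Host emb m

  Target : History → Set
  Target h =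
    Cycle (HostEdge h red) k
    ⊎ Σ ℕ λ ℓ → Σ (Cycle (HostEdge h blue) ℓ) λ C →
        Cycle.AllVertices C InTail × m ∸ k < ℓ × ℓ ≤ suc m ×
        Cycle.HasEdge C (u 0) (u 1)

{-# OPTIONS --safe #-}
module Submission where

-- Builder first asks u₀u_{m−2}; blue closes the blue cycle u₀u₁…u_{m−2}.  For k = 2a + 3 ≥ 5
-- he then asks u₀u_{a+1}: red closes a red C_k with the red tail path from u₀ to u_{a+1}, and
-- blue either closes a long blue cycle u₀…u_{a+1} or fixes the lower end of a bisection.
-- Throughout the bisection there are a blue edge u₀u_lo (the tail edge u₀u₁ while lo = 1) and a
-- red edge u₀u_hi, and Builder asks u₀u_mid, halving the gap.  Once hi = lo + 1, at most three
-- more edges among u₀, u_{m−2} and vertices next to u_hi are asked: every red answer closes a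
-- red cycle of length k with a red stretch of the tail, every blue answer a blue cycle through
-- u₀u₁ on more than m − k tail vertices.  Since 2^t (gap − 1) ≤ 4m is maintained, the game lasts
-- fewer than log₂ m + 8 rounds.

open import Defs
open import Data.Nat
  using (ℕ; zero; suc; _+_; _*_; _∸_; _^_; _/_; _≤_; _<_; _≤?_; _≟_; z≤n; s≤s; ⌊_/2⌋; ⌈_/2⌉)
open import Data.Nat.Properties
open import Data.Nat.DivMod using (m≡m%n+[m/n]*n)
open import Data.Empty using (⊥-elim)
open import Data.Product using (Σ; _×_; _,_; proj₁; proj₂)
open import Data.Sum using (_⊎_; inj₁; inj₂)
import Data.Sum as Sum
open import Data.List using ([]; _∷_)
open import Data.List.Relation.Unary.All as All using (All; []; _∷_)
open import Data.List.Relation.Unary.Any using (here; there)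
open import Data.List.Membership.Propositional using (_∈_; _∉_)
open import Function using (_∘_)
open import Data.Nat.Tactic.RingSolver using (solve-∀)
open import Relation.Nullary using (¬_; yes; no)
open import Relation.Binary.Definitions using (Symmetric)
open import Relation.Binary.PropositionalEquality
  using (_≡_; _≢_; refl; sym; trans; cong; cong₂; subst; subst₂; module ≡-Reasoning)

evenOrOdd : ∀ q → (Σ ℕ λ j → q ≡ 2 * j) ⊎ (Σ ℕ λ j → q ≡ suc (2 * j))
evenOrOdd zero = inj₁ (0 , refl)
evenOrOdd (suc q) with evenOrOdd q
... | inj₁ (j , q≡) = inj₂ (j , cong suc q≡)
... | inj₂ (j , q≡) = inj₁ (suc j , trans (cong suc q≡) (sym (*-suc 2 j)))

2*⌊n/2⌋≤n : ∀ n → 2 * ⌊ n /2⌋ ≤ n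
2*⌊n/2⌋≤n zero          = z≤n
2*⌊n/2⌋≤n (suc zero)    = z≤n
2*⌊n/2⌋≤n (suc (suc n)) = subst (_≤ 2 + n) (sym (*-suc 2 ⌊ n /2⌋)) (s≤s (s≤s (2*⌊n/2⌋≤n n)))

splice : ℕ → (ℕ → ℕ) → (ℕ → ℕ) → ℕ → ℕ
splice zero    f g i       = g i
splice (suc n) f g zero    = f zero
splice (suc n) f g (suc i) = splice n (f ∘ suc) g i

splice-< : ∀ n f g {i} → i < n → splice n f g i ≡ f i
splice-< (suc n) f g {zero}  _         = refl
splice-< (suc n) f g {suc i} (s≤s i<n) = splice-< n (f ∘ suc) g i<n

splice-+ : ∀ n f g j → splice n f g (n + j) ≡ g j
splice-+ zero    f g j = refl
splice-+ (suc n) f g j = splice-+ n (f ∘ suc) g j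

splice-last : ∀ n f g → splice (suc n) f g n ≡ f n
splice-last n f g = splice-< (suc n) f g ≤-refl

data Split (n : ℕ) : ℕ → Set where
  before : ∀ {i} → i < n → Split n i
  after  : ∀ j → Split n (n + j)

split : ∀ n i → Split n i
split zero    i       = after i
split (suc n) zero    = before (s≤s z≤n)
split (suc n) (suc i) with split n i
... | before i<n = before (s≤s i<n)
... | after j    = after j

record Path (V : ℕ → Set) (R : ℕ → ℕ → Set) (ℓ : ℕ) : Set where
  field
    at       : ℕ → ℕ
    valid    : ∀ i → i < ℓ → V (at i)
    distinct : InjectiveBelow ℓ at
    link     : ∀ i → suc i < ℓ → R (at i) (at (suc i))

module _ {V : ℕ → Set} {R : ℕ → ℕ → Set} where
  open Path

  [_] : ∀ {x} → V x → Path V R 1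
  [_] {x} vx = record
    { at = λ _ → x ; valid = λ _ _ → vx
    ; distinct = λ { zero zero _ _ _ → refl ; _ (suc _) _ (s≤s ()) _ ; (suc _) _ (s≤s ()) _ _ }
    ; link = λ _ → λ { (s≤s ()) } }

  append : ∀ {n ℓ} (P : Path V R (suc n)) (Q : Path V R ℓ) →
           (∀ i j → i < suc n → j < ℓ → at P i ≢ at Q j) →
           R (at P n) (at Q 0) → Path V R (suc n + ℓ)
  append {n} {ℓ} P Q disjoint bridge = record
    { at = s ; valid = valid′ ; distinct = distinct′ ; link = link′ }
    where
    s : ℕ → ℕ
    s = splice (suc n) (at P) (at Q)
    left : ∀ {i} → i < suc n → s i ≡ at P i
    left = splice-< (suc n) (at P) (at Q)
    right : ∀ j → s (suc n + j) ≡ at Q j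
    right = splice-+ (suc n) (at P) (at Q)
    inQ : ∀ {j} → suc n + j < suc n + ℓ → j < ℓ
    inQ = +-cancelˡ-< (suc n) _ ℓ
    valid′ : ∀ i → i < suc n + ℓ → V (s i)
    valid′ i i< with split (suc n) i
    ... | before p = subst V (sym (left p)) (valid P i p)
    ... | after j  = subst V (sym (right j)) (valid Q j (inQ i<))
    distinct′ : InjectiveBelow (suc n + ℓ) s
    distinct′ i j i< j< e with split (suc n) i | split (suc n) j
    ... | before p | before q = distinct P i j p q (trans (sym (left p)) (trans e (left q)))
    ... | before p | after j′ =
      ⊥-elim (disjoint i j′ p (inQ j<) (trans (sym (left p)) (trans e (right j′))))
    ... | after i′ | before q =
      ⊥-elim (disjoint j i′ q (inQ i<) (trans (sym (left q)) (trans (sym e) (right i′))))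
    ... | after i′ | after j′ =
      cong (suc n +_) (distinct Q i′ j′ (inQ i<) (inQ j<) (trans (sym (right i′)) (trans e (right j′))))
    link′ : ∀ i → suc i < suc n + ℓ → R (s i) (s (suc i))
    link′ i i< with split n i
    ... | before p = subst₂ R (sym (left (m≤n⇒m≤1+n p))) (sym (left (s≤s p))) (link P i (s≤s p))
    ... | after zero = subst (λ x → R (s x) (s (suc x))) (sym (+-identityʳ n))
                         (subst₂ R (sym (splice-last n (at P) (at Q)))
                                  (sym (trans (cong s (sym (+-identityʳ (suc n)))) (right 0))) bridge)
    ... | after (suc j) = subst₂ R (sym (trans (cong s (+-suc n j)) (right j))) (sym (right (suc j)))
                            (link Q j (inQ i<))

  reverse : Symmetric R → ∀ {n} → Path V R (suc n) → Path V R (suc n)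
  reverse R-sym {n} P = record
    { at       = λ i → at P (n ∸ i)
    ; valid    = λ i _ → valid P (n ∸ i) (inside i)
    ; distinct = λ i j i< j< e →
        ∸-cancelˡ-≡ (≤-pred i<) (≤-pred j<) (distinct P _ _ (inside i) (inside j) e)
    ; link     = λ i i< → subst (λ x → R (at P x) (at P (n ∸ suc i))) (sym (descend i<))
                                (R-sym (link P (n ∸ suc i) (subst (_< suc n) (descend i<) (inside i))))
    }
    where
    inside : ∀ i → n ∸ i < suc n
    inside i = s≤s (m∸n≤m n i)
    descend : ∀ {i} → suc i < suc n → n ∸ i ≡ suc (n ∸ suc i)
    descend i< = +-∸-assoc 1 (≤-pred i<)

  toCycle : ∀ {n} (P : Path V R (suc n)) → 2 ≤ n → R (at P n) (at P 0) → Cycle R (suc n)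
  toCycle P n≥2 closing = record
    { v = at P ; len≥3 = s≤s n≥2 ; inj = distinct P ; path = link P ; close = closing }

mapCycle : ∀ {R E : ℕ → ℕ → Set} {ℓ N} (f : ℕ → ℕ) → InjectiveBelow N f →
           (∀ {x y} → R x y → E (f x) (f y)) →
           (C : Cycle R ℓ) → Cycle.AllVertices C (_< N) → Cycle E ℓ
mapCycle f f-inj hom C below = record
  { v     = f ∘ v
  ; len≥3 = len≥3
  ; inj   = λ i j i< j< e → inj i j i< j< (f-inj _ _ (below i i<) (below j j<) e)
  ; path  = λ i i< → hom (path i i<)
  ; close = hom close
  }
  where open Cycle C

odd : ℕ → ℕ
odd i = suc (2 * i)

data TailStep : ℕ → ℕ → Set where
  red₁ : ∀ i → TailStep (2 * i) (suc (2 * i))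
  red₂ : ∀ i → TailStep (suc (2 * i)) (2 + 2 * i)
  blue : ∀ i → TailStep (2 * i) (2 + 2 * i)

TailAdjacent : ℕ → ℕ → Set
TailAdjacent p q = TailStep p q ⊎ TailStep q p

tailStep-< : ∀ {p q} → TailStep p q → p < q × q ≤ 2 + p
tailStep-< (red₁ i) = n<1+n _ , m≤n+m _ 1
tailStep-< (red₂ i) = n<1+n _ , m≤n+m _ 1
tailStep-< (blue i) = m<n+m (2 * i) {2} (s≤s z≤n) , ≤-refl

far⇒¬tailAdjacent : ∀ {p q} → 3 + p ≤ q → ¬ TailAdjacent p q
far⇒¬tailAdjacent far (inj₁ s) = <⇒≱ far (proj₂ (tailStep-< s))
far⇒¬tailAdjacent far (inj₂ s) = <⇒≱ (proj₁ (tailStep-< s)) (≤-trans (m≤n+m _ 3) far)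

odd⇒¬tailStep : ∀ {p q a b} → p ≡ odd a → q ≡ odd b → ¬ TailStep p q
odd⇒¬tailStep {a = a} p≡ _ (red₁ i) = even≢odd i a p≡
odd⇒¬tailStep {b = b} _ q≡ (red₂ i) = even≢odd (suc i) b (trans (*-suc 2 i) q≡)
odd⇒¬tailStep {a = a} p≡ _ (blue i) = even≢odd i a p≡

odd⇒¬tailAdjacent : ∀ a b → ¬ TailAdjacent (odd a) (odd b)
odd⇒¬tailAdjacent a b (inj₁ s) = odd⇒¬tailStep {a = a} {b} refl refl s
odd⇒¬tailAdjacent a b (inj₂ s) = odd⇒¬tailStep {a = b} {a} refl refl s

AllQueries : (Edge → Set) → History → Set
AllQueries P = All (P ∘ proj₁)

unqueried : ∀ {P h x y c} → AllQueries P h → ¬ P (x , y) → ((x , y) , c) ∉ h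
unqueried all ¬P mv = ¬P (All.lookup all mv)

module EmbeddedTail (m : ℕ) (emb : ℕ → ℕ) (emb-inj : InjectiveBelow (1 + 2 * m) emb) where
  open Tail emb m
  open Host emb m
  open Path

  Position : ℕ → Set
  Position p = p < 1 + 2 * m

  emb-injective : ∀ {p q} → Position p → Position q → emb p ≡ emb q → p ≡ q
  emb-injective = emb-inj _ _

  2*-injective : ∀ {i j} → 2 * i ≡ 2 * j → i ≡ j
  2*-injective = *-cancelˡ-≡ _ _ 2

  u-position : ∀ {i} → i ≤ m → Position (2 * i)
  u-position i≤m = s≤s (*-monoʳ-≤ 2 i≤m)

  u-injective : ∀ {i j} → i ≤ m → j ≤ m → u i ≡ u j → i ≡ j
  u-injective i≤m j≤m e = 2*-injective (emb-injective (u-position i≤m) (u-position j≤m) e)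

  w-position : ∀ {i} → i < m → Position (odd i)
  w-position {i} i<m = s≤s (≤-trans (n≤1+n _) (subst (_≤ 2 * m) (*-suc 2 i) (*-monoʳ-≤ 2 i<m)))

  w≡emb : ∀ i → w (suc i) ≡ emb (odd i)
  w≡emb i = cong (λ x → emb (x ∸ 1)) (*-suc 2 i)

  u≡emb-suc : ∀ i → u (suc i) ≡ emb (2 + 2 * i)
  u≡emb-suc i = cong emb (*-suc 2 i)

  sameEdge⇒adjacent : ∀ {a b p q} → TailStep a b → Position a → Position b → Position p → Position q →
                      SameEdge (emb a) (emb b) (emb p) (emb q) → TailAdjacent p q
  sameEdge⇒adjacent s a b p q (inj₁ (a≡p , b≡q))
    rewrite emb-injective a p a≡p | emb-injective b q b≡q = inj₁ s
  sameEdge⇒adjacent s a b p q (inj₂ (a≡q , b≡p))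
    rewrite emb-injective a q a≡q | emb-injective b p b≡p = inj₂ s

  tailEdge⇒adjacent : ∀ c {p q} → Position p → Position q → TailEdge c (emb p) (emb q) → TailAdjacent p q
  tailEdge⇒adjacent red {p} {q} p< q< (suc j , _ , j<m , inj₁ e) =
    sameEdge⇒adjacent (red₁ j) (u-position (<⇒≤ j<m)) (w-position j<m) p< q<
      (subst (λ x → SameEdge (u j) x (emb p) (emb q)) (w≡emb j) e)
  tailEdge⇒adjacent red {p} {q} p< q< (suc j , _ , j<m , inj₂ e) =
    sameEdge⇒adjacent (red₂ j) (w-position j<m) (subst Position (*-suc 2 j) (u-position j<m)) p< q<
      (subst₂ (λ x y → SameEdge x y (emb p) (emb q)) (w≡emb j) (u≡emb-suc j) e)
  tailEdge⇒adjacent blue {p} {q} p< q< (i , i<m , e) =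
    sameEdge⇒adjacent (blue i) (u-position (<⇒≤ i<m)) (subst Position (*-suc 2 i) (u-position i<m)) p< q<
      (subst (λ x → SameEdge (u i) x (emb p) (emb q)) (u≡emb-suc i) e)

  legal : ∀ {h p q} → Position p → Position q → p ≢ q → ¬ TailAdjacent p q →
          (∀ c → ((emb p , emb q) , c) ∉ h) → (∀ c → ((emb q , emb p) , c) ∉ h) →
          Legal h (emb p , emb q)
  legal p q p≢q ¬adj new new′ = (λ e → p≢q (emb-injective p q e)) , unused
    where
    unused : ∀ c → ¬ HostEdge _ c (emb _) (emb _)
    unused c (inj₁ e)         = ¬adj (tailEdge⇒adjacent c p q e)
    unused c (inj₂ (inj₁ mv)) = new c mv
    unused c (inj₂ (inj₂ mv)) = new′ c mv

  u≢u₀ : ∀ {j} → 1 ≤ j → j ≤ m → u j ≢ u 0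
  u≢u₀ j≥1 j≤m eq = <⇒≢ j≥1 (sym (u-injective j≤m z≤n eq))

  legal-u₀u : ∀ {h j} → 2 ≤ j → j ≤ m →
              (∀ c → ((u 0 , u j) , c) ∉ h) → (∀ c → ((u j , u 0) , c) ∉ h) → Legal h (u 0 , u j)
  legal-u₀u {j = j} j≥2 j≤m = legal (u-position z≤n) (u-position j≤m) (<⇒≢ 0<2j)
                                    (far⇒¬tailAdjacent (≤-trans (n≤1+n 3) (*-monoʳ-≤ 2 j≥2)))
    where
    0<2j : 0 < 2 * j
    0<2j = ≤-trans (s≤s z≤n) (*-monoʳ-≤ 2 j≥2)

  hostEdge-sym : ∀ {h c} → Symmetric (HostEdge h c)
  hostEdge-sym {c = red}  (inj₁ (i , i≥1 , i≤m , e)) = inj₁ (i , i≥1 , i≤m , Sum.map Sum.swap Sum.swap e)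
  hostEdge-sym {c = blue} (inj₁ (i , i<m , e))      = inj₁ (i , i<m , Sum.swap e)
  hostEdge-sym (inj₂ (inj₁ mv)) = inj₂ (inj₂ mv)
  hostEdge-sym (inj₂ (inj₂ mv)) = inj₂ (inj₁ mv)

  earlier : ∀ {h c x y} mv → HostEdge h c x y → HostEdge (mv ∷ h) c x y
  earlier _ (inj₁ e)         = inj₁ e
  earlier _ (inj₂ (inj₁ mv)) = inj₂ (inj₁ (there mv))
  earlier _ (inj₂ (inj₂ mv)) = inj₂ (inj₂ (there mv))

  red-step : ∀ {h} q → suc q < 1 + 2 * m → HostEdge h red (emb q) (emb (suc q))
  red-step q q< with evenOrOdd q
  ... | inj₁ (j , refl) =
    inj₁ (suc j , s≤s z≤n , *-cancelˡ-< 2 j m (≤-pred q<) , inj₁ (inj₁ (refl , w≡emb j)))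
  ... | inj₂ (j , refl) =
    inj₁ (suc j , s≤s z≤n , *-cancelˡ-≤ 2 (subst (_≤ 2 * m) (sym (*-suc 2 j)) (≤-pred q<)) ,
          inj₂ (inj₁ (w≡emb j , u≡emb-suc j)))

  HostPath : History → Color → ℕ → Set
  HostPath h c = Path Position (λ p q → HostEdge h c (emb p) (emb q))

  redArc : ∀ {h} p L → Position (p + L) → HostPath h red (suc L)
  redArc {h} p L bound = record
    { at       = p +_
    ; valid    = λ i i< → s≤s (inside (≤-pred i<))
    ; distinct = λ i j _ _ → +-cancelˡ-≡ p i j
    ; link     = λ i i< → subst (λ x → HostEdge h red (emb (p + i)) (emb x)) (sym (+-suc p i))
                                (red-step (p + i) (s≤s (subst (_≤ 2 * m) (+-suc p i) (inside (≤-pred i<)))))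
    }
    where
    inside : ∀ {i} → i ≤ L → p + i ≤ 2 * m
    inside i≤L = ≤-trans (+-monoʳ-≤ p i≤L) (≤-pred bound)

  uArc : ∀ {h} b L → b + L ≤ m → HostPath h blue (suc L)
  uArc b L bound = record
    { at       = λ s → 2 * (b + s)
    ; valid    = λ s s< → u-position (inside (≤-pred s<))
    ; distinct = λ i j _ _ e → +-cancelˡ-≡ b i j (2*-injective e)
    ; link     = λ s s< → inj₁ (b + s , subst (_≤ m) (+-suc b s) (inside (≤-pred s<)) ,
                                inj₁ (refl , cong (λ x → emb (2 * x)) (sym (+-suc b s))))
    }
    where
    inside : ∀ {s} → s ≤ L → b + s ≤ m
    inside s≤L = ≤-trans (+-monoʳ-≤ b s≤L) bound

  hostCycle : ∀ {h c n} (P : HostPath h c (suc n)) → 2 ≤ n →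
              HostEdge h c (emb (at P n)) (emb (at P 0)) → Cycle (HostEdge h c) (suc n)
  hostCycle P n≥2 closing = mapCycle emb emb-inj (λ e → e) (toCycle P n≥2 closing) (valid P)

  BlueThroughTail : History → ℕ → Set
  BlueThroughTail h ℓ = Σ (Cycle (HostEdge h blue) ℓ) λ C →
                          Cycle.AllVertices C InTail × Cycle.HasEdge C (u 0) (u 1)

  blueCycle : ∀ {h n} (P : HostPath h blue (suc n)) → 2 ≤ n →
              HostEdge h blue (emb (at P n)) (emb (at P 0)) →
              ∀ k → suc k < suc n → at P k ≡ 0 → at P (suc k) ≡ 2 → BlueThroughTail h (suc n)
  blueCycle P n≥2 closing k k< first second =
    hostCycle P n≥2 closing ,
    (λ i i< → at P i , ≤-pred (valid P i i<) , refl) ,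
    inj₁ (k , k< , inj₁ (cong emb (sym first) , cong emb (sym second)))

  redChordCycle : ∀ {h} p L → 2 ≤ L → Position (p + L) →
                  HostEdge h red (emb (p + L)) (emb p) → Cycle (HostEdge h red) (suc L)
  redChordCycle {h} p L L≥2 bound chord =
    hostCycle (redArc p L bound) L≥2
      (subst (λ x → HostEdge h red (emb (p + L)) (emb x)) (sym (+-identityʳ p)) chord)

  redApexCycle : ∀ {h} p t q → 1 ≤ t → Position (p + t) → Position q → q < p ⊎ p + t < q →
                 HostEdge h red (emb (p + t)) (emb q) → HostEdge h red (emb q) (emb p) →
                 Cycle (HostEdge h red) (2 + t)
  redApexCycle {h} p t q t≥1 bound q-pos outside in₁ in₂ =
    hostCycle (append [ q-pos ] (redArc p t bound) apart
                 (subst (λ x → HostEdge h red (emb q) (emb x)) (sym (+-identityʳ p)) in₂))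
              (s≤s t≥1) in₁
    where
    apart : ∀ i j → i < 1 → j < suc t → q ≢ p + j
    apart _ j _ j< q≡ = Sum.[ (λ q<p → <⇒≱ q<p (subst (p ≤_) (sym q≡) (m≤m+n p j)))
                            , (λ q>  → <⇒≱ q> (subst (_≤ p + t) (sym q≡) (+-monoʳ-≤ p (≤-pred j<)))) ]′ outside

  blueChordCycle : ∀ {h} j → 2 ≤ j → j ≤ m → HostEdge h blue (u j) (u 0) → BlueThroughTail h (suc j)
  blueChordCycle j j≥2 j≤m chord =
    blueCycle (uArc 0 j j≤m) j≥2 chord 0 (s≤s (≤-trans (s≤s z≤n) j≥2)) refl refl

  blueDetourCycle : ∀ {h} j y x → 1 ≤ j → j ≤ m → y < m → x < m → y ≢ x →
                    HostEdge h blue (u j) (emb (odd y)) →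
                    HostEdge h blue (emb (odd y)) (emb (odd x)) →
                    HostEdge h blue (emb (odd x)) (u 0) →
                    BlueThroughTail h (3 + j)
  blueDetourCycle {h} j y x j≥1 j≤m y<m x<m y≢x in₁ mid out =
    blueCycle (append [ w-position y<m ] rest y-off mid) (s≤s (s≤s z≤n)) in₁
              2 (s≤s (s≤s (s≤s j≥1))) refl refl
    where
    rest : HostPath h blue (2 + j)
    rest = append [ w-position x<m ] (uArc 0 j j≤m) (λ _ i _ _ e → even≢odd i x (sym e)) out
    y-off : ∀ a i → a < 1 → i < 1 + suc j → odd y ≢ at rest i
    y-off _ zero    _ _ e = y≢x (2*-injective (suc-injective e))
    y-off _ (suc i) _ _ e = even≢odd i y (sym e)

  blueSkipCycle : ∀ {h} c b q → suc c < b → b + q ≤ m →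
                  HostEdge h blue (u (suc c)) (u (b + q)) → HostEdge h blue (u b) (u 0) →
                  BlueThroughTail h (2 + c + suc q)
  blueSkipCycle {h} c b q c<b bound jump back =
    blueCycle P (s≤s (subst (1 ≤_) (sym (+-suc c q)) (s≤s z≤n)))
              (subst (λ x → HostEdge h blue (emb x) (u 0)) (sym last) back)
              0 (s≤s (s≤s z≤n)) refl refl
    where
    up : HostPath h blue (2 + c)
    up = uArc 0 (suc c) (≤-trans (<⇒≤ c<b) (≤-trans (m≤m+n b q) bound))
    down : HostPath h blue (suc q)
    down = reverse hostEdge-sym (uArc b q bound)
    apart : ∀ i j → i < 2 + c → j < suc q → at up i ≢ at down j
    apart i j i< _ e = <⇒≱ (≤-trans i< c<b)
                            (subst (b ≤_) (sym (2*-injective e)) (m≤m+n b (q ∸ j)))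
    P : HostPath h blue (2 + c + suc q)
    P = append up down apart jump
    last : at P (suc c + suc q) ≡ 2 * b
    last = begin
      at P (suc c + suc q)   ≡⟨ cong (at P) (+-suc (suc c) q) ⟩
      at P (2 + c + q)       ≡⟨ splice-+ (2 + c) (at up) (at down) q ⟩
      2 * (b + (q ∸ q))      ≡⟨ cong (λ x → 2 * (b + x)) (n∸n≡0 q) ⟩
      2 * (b + 0)            ≡⟨ cong (2 *_) (+-identityʳ b) ⟩
      2 * b                  ∎
      where open ≡-Reasoning

module Strategy (z : ℕ) (emb : ℕ → ℕ) (emb-inj : InjectiveBelow (1 + 2 * (2 + z)) emb) where
  m : ℕ
  m = 2 + z

  open Tail emb m
  open Host emb m
  open EmbeddedTail m emb emb-inj
  open Path

  z≤m : z ≤ m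
  z≤m = m≤n+m z 2

  K : ℕ → ℕ
  K a = suc (2 * suc a)

  -- Endgame probes, for lo = a + 1 + e and hi = lo + 1.  With X = xIdx + 1, Y = yIdx + 1 and
  -- C = cIdx, the tail paths from u_hi to w_X, from w_Y to w_X and from u_C to w_Y have lengths
  -- k − 2, k − 1 and k − 2, so a red u₀w_X, a red w_Yw_X, or red w_Yu_z and u_Cu_z close a red C_k.
  xIdx yIdx cIdx : ℕ → ℕ → ℕ
  xIdx zero    e = suc e
  xIdx (suc b) e = (2 + b + e) + (2 + b)
  yIdx zero    e = e
  yIdx (suc b) e = 2 + b + e
  cIdx zero    e = e
  cIdx (suc b) e = suc e

  data Phase : Set where
    opening second over           : Phase
    bisect                        : ℕ → ℕ → Phase
    endgame endgameBlue endgameRed : ℕ → Phase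

  query : ℕ → Phase → Edge
  query a opening                  = (u 0 , u z)
  query a second                   = (u 0 , u (suc a))
  query a (bisect e (suc (suc g))) = (u 0 , u (suc a + e + ⌊ 2 + g /2⌋))
  query a (bisect e _)             = (u 0 , emb (odd (xIdx a e)))
  query a (endgame e)              = (emb (odd (yIdx a e)) , u z)
  query a (endgameBlue e)          = (emb (odd (yIdx a e)) , emb (odd (xIdx a e)))
  query a (endgameRed e)           = (u (cIdx a e) , u z)
  query a over                     = (0 , 0)   -- never asked: the game ends before

  afterOpening : ℕ → Phase
  afterOpening zero    = bisect 0 (z ∸ 1)
  afterOpening (suc a) = second

  step : ℕ → Phase → Color → Phase
  step a opening red                = afterOpening a
  step a second blue                = bisect 0 (z ∸ suc a)
  step a (bisect e (suc (suc g))) red  = bisect e ⌊ 2 + g /2⌋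
  step a (bisect e (suc (suc g))) blue = bisect (e + ⌊ 2 + g /2⌋) ⌈ 2 + g /2⌉
  step a (bisect e _) blue          = endgame e
  step a (endgame e) red            = endgameRed e
  step a (endgame e) blue           = endgameBlue e
  step a _ _                        = over

  phaseAfter : ℕ → History → Phase
  phaseAfter a []             = opening
  phaseAfter a ((_ , c) ∷ h) = step a (phaseAfter a h) c

  builder : ℕ → BuilderStrategy
  builder a h = query a (phaseAfter a h)

  LongBlue : ℕ → History → Set
  LongBlue a h = Σ ℕ λ ℓ → BlueThroughTail h ℓ × m ∸ K a < ℓ × ℓ ≤ suc m

  record EndgameGeometry (a e : ℕ) : Set where
    field
      x≥1    : 1 ≤ xIdx a e
      x<m    : xIdx a e < m
      y+2≤z  : yIdx a e + 2 ≤ z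
      y≢x    : yIdx a e ≢ xIdx a e
      c≥1    : suc a + e ≢ 1 → 1 ≤ cIdx a e
      c+2≤z  : cIdx a e + 2 ≤ z
      red-x  : ∀ {h} → HostEdge h red (u 0) (u (2 + a + e)) → HostEdge h red (u 0) (emb (odd (xIdx a e))) →
               Cycle (HostEdge h red) (K a)
      red-yx : ∀ {h} → HostEdge h red (emb (odd (yIdx a e))) (emb (odd (xIdx a e))) → Cycle (HostEdge h red) (K a)
      red-yz : ∀ {h} → HostEdge h red (emb (odd (yIdx a e))) (u z) → HostEdge h red (u (cIdx a e)) (u z) →
               Cycle (HostEdge h red) (K a)
      blue-yx : ∀ {h} → HostEdge h blue (emb (odd (yIdx a e))) (u z) →
                HostEdge h blue (emb (odd (yIdx a e))) (emb (odd (xIdx a e))) →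
                HostEdge h blue (u 0) (emb (odd (xIdx a e))) → LongBlue a h
      blue-cz : suc a + e ≢ 1 → ∀ {h} → HostEdge h blue (u (cIdx a e)) (u z) →
                HostEdge h blue (u (suc a + e)) (u 0) → LongBlue a h

  longDetour : ∀ {a h} y x → y + 2 ≤ z → x < m → y ≢ x →
               HostEdge h blue (emb (odd y)) (u z) → HostEdge h blue (emb (odd y)) (emb (odd x)) →
               HostEdge h blue (u 0) (emb (odd x)) → LongBlue a h
  longDetour {a} y x y+2≤z x<m y≢x in₁ mid out =
    suc m ,
    blueDetourCycle z y x (≤-trans (s≤s z≤n) (≤-trans (m≤n+m 2 y) y+2≤z)) z≤m
      (≤-trans (m<m+n y (s≤s z≤n)) (≤-trans y+2≤z z≤m)) x<m y≢x
      (hostEdge-sym in₁) mid (hostEdge-sym out) ,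
    s≤s (m∸n≤m m (K a)) , ≤-refl

  longSkip : ∀ {a h} c b → suc c < b → b ≤ z → b ≤ suc c + suc a →
             HostEdge h blue (u (suc c)) (u z) → HostEdge h blue (u b) (u 0) → LongBlue a h
  longSkip {a} {h} c b c<b b≤z b≤ jump back =
    2 + c + suc q ,
    blueSkipCycle c b q c<b (≤-trans (≤-reflexive b+q≡z) z≤m)
      (subst (λ x → HostEdge h blue (u (suc c)) (u x)) (sym b+q≡z) jump) back ,
    m<n+o⇒m∸n<o m (K a) long , short
    where
    q : ℕ
    q = z ∸ b
    b+q≡z : b + q ≡ z
    b+q≡z = m+[n∸m]≡n b≤z
    short : 2 + c + suc q ≤ suc m
    short = begin
      2 + c + suc q  ≤⟨ +-monoˡ-≤ (suc q) c<b ⟩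
      b + suc q      ≡⟨ +-suc b q ⟩
      suc (b + q)    ≡⟨ cong suc b+q≡z ⟩
      suc z          ≤⟨ s≤s z≤m ⟩
      suc m          ∎
      where open ≤-Reasoning
    long : m < K a + (2 + c + suc q)
    long = begin-strict
      2 + z                        ≡⟨ cong (2 +_) (sym b+q≡z) ⟩
      2 + (b + q)                  ≤⟨ +-monoʳ-≤ 2 (+-monoˡ-≤ q b≤) ⟩
      2 + (suc c + suc a + q)      <⟨ m<m+n _ (s≤s z≤n) ⟩
      2 + (suc c + suc a + q) + suc (suc a)  ≡⟨ lemma a c q ⟩
      K a + (2 + c + suc q)        ∎
      where
      open ≤-Reasoning
      lemma : ∀ a c q → 2 + (suc c + suc a + q) + suc (suc a) ≡ suc (2 * suc a) + (2 + c + suc q)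
      lemma = solve-∀

  skip₀ : ∀ e → 2 + e ≤ z → suc e ≢ 1 →
          ∀ {h} → HostEdge h blue (u e) (u z) → HostEdge h blue (u (suc e)) (u 0) → LongBlue 0 h
  skip₀ zero    _    lo≢1 = ⊥-elim (lo≢1 refl)
  skip₀ (suc c) hi≤z _    = longSkip {0} c (2 + c) ≤-refl (≤-trans (n≤1+n _) hi≤z) (≤-reflexive (+-comm 1 (suc c)))

  geometry₀ : ∀ e → 2 + e ≤ z → EndgameGeometry 0 e
  geometry₀ e hi≤z = record
    { x≥1 = s≤s z≤n ; x<m = ≤-trans hi≤z z≤m ; y+2≤z = e+2≤z ; y≢x = e≢1+e ; c≥1 = c≥1 ; c+2≤z = e+2≤z
    ; red-x = red-x ; red-yx = red-yx ; red-yz = red-yz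
    ; blue-yx = longDetour {0} e (suc e) e+2≤z (≤-trans hi≤z z≤m) e≢1+e
    ; blue-cz = skip₀ e hi≤z }
    where
    e+2≤z : e + 2 ≤ z
    e+2≤z = subst (_≤ z) (+-comm 2 e) hi≤z
    e≢1+e : e ≢ suc e
    e≢1+e e≡ = <-irrefl e≡ ≤-refl
    c≥1 : suc e ≢ 1 → 1 ≤ e
    c≥1 lo≢1 = n≢0⇒n>0 (λ e≡0 → lo≢1 (cong suc e≡0))
    red-x : ∀ {h} → HostEdge h red (u 0) (u (2 + e)) → HostEdge h red (u 0) (emb (odd (suc e))) →
            Cycle (HostEdge h red) 3
    red-x {h} hi x = redApexCycle (odd (suc e)) 1 0 ≤-refl
                       (subst Position (sym (shift e)) (u-position (≤-trans hi≤z z≤m)))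
                       (s≤s z≤n) (inj₁ (s≤s z≤n))
                       (subst (λ p → HostEdge h red (emb p) (u 0)) (sym (shift e)) (hostEdge-sym hi)) x
      where
      shift : ∀ e → suc (2 * suc e) + 1 ≡ 2 * (2 + e)
      shift = solve-∀
    red-yx : ∀ {h} → HostEdge h red (emb (odd e)) (emb (odd (suc e))) → Cycle (HostEdge h red) 3
    red-yx {h} yx = redChordCycle (odd e) 2 ≤-refl
                      (subst Position (sym (shift e)) (w-position (≤-trans hi≤z z≤m)))
                      (subst (λ p → HostEdge h red (emb p) (emb (odd e))) (sym (shift e)) (hostEdge-sym yx))
      where
      shift : ∀ e → suc (2 * e) + 2 ≡ suc (2 * suc e)
      shift = solve-∀
    red-yz : ∀ {h} → HostEdge h red (emb (odd e)) (u z) → HostEdge h red (u e) (u z) → Cycle (HostEdge h red) 3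
    red-yz {h} yz ez = redApexCycle (2 * e) 1 (2 * z) ≤-refl
                         (subst Position (+-comm 1 (2 * e)) (w-position (≤-trans (m<m+n e (s≤s z≤n)) (≤-trans e+2≤z z≤m))))
                         (u-position z≤m)
                         (inj₂ (subst (_≤ 2 * z) (shift e) (*-monoʳ-≤ 2 (≤-trans (n≤1+n _) hi≤z))))
                         (subst (λ p → HostEdge h red (emb p) (u z)) (+-comm 1 (2 * e)) yz) (hostEdge-sym ez)
      where
      shift : ∀ e → 2 * suc e ≡ suc (2 * e + 1)
      shift = solve-∀

  geometry₊ : ∀ b e → K (suc b) + (2 + b + e) < m → EndgameGeometry (suc b) e
  geometry₊ b e room = record
    { x≥1 = s≤s z≤n ; x<m = x<m ; y+2≤z = lo+2≤z ; y≢x = lo≢lo+D ; c≥1 = λ _ → s≤s z≤n ; c+2≤z = c+2≤z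
    ; red-x = red-x ; red-yx = red-yx ; red-yz = red-yz
    ; blue-yx = longDetour {suc b} lo (lo + D) lo+2≤z x<m lo≢lo+D
    ; blue-cz = λ _ → longSkip {suc b} e lo (+-monoˡ-≤ e (s≤s (s≤s z≤n))) (≤-trans (m≤m+n lo 2) lo+2≤z)
                                 (≤-trans (n≤1+n lo) (≤-reflexive (swap b e))) }
    where
    D lo : ℕ
    D  = 2 + b
    lo = D + e
    wide : 2 * D + lo ≤ z
    wide = ≤-pred (≤-pred room)
    ≤-wide : ∀ s t → s + t ≡ 2 * D + lo → s ≤ z
    ≤-wide s t eq = ≤-trans (m+n≤o⇒m≤o s (≤-reflexive eq)) wide
    x<m : suc (lo + D) ≤ m
    x<m = ≤-trans (≤-wide (suc (lo + D)) (suc b) (shift b e)) z≤m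
      where
      shift : ∀ b e → suc (2 + b + e + (2 + b)) + suc b ≡ 2 * (2 + b) + (2 + b + e)
      shift = solve-∀
    lo+2≤z : lo + 2 ≤ z
    lo+2≤z = ≤-wide (lo + 2) (2 * suc b) (shift b e)
      where
      shift : ∀ b e → 2 + b + e + 2 + 2 * suc b ≡ 2 * (2 + b) + (2 + b + e)
      shift = solve-∀
    c+2≤z : suc e + 2 ≤ z
    c+2≤z = ≤-wide (suc e + 2) (3 * suc b) (shift b e)
      where
      shift : ∀ b e → suc e + 2 + 3 * suc b ≡ 2 * (2 + b) + (2 + b + e)
      shift = solve-∀
    swap : ∀ b e → 3 + b + e ≡ suc e + suc (suc b)
    swap = solve-∀
    lo≢lo+D : lo ≢ lo + D
    lo≢lo+D eq with +-cancelˡ-≡ lo 0 D (trans (+-identityʳ lo) eq)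
    ... | ()
    2+2t≡K : 2 + suc (2 * suc b) ≡ K (suc b)
    2+2t≡K = cong suc (sym (*-suc 2 (suc b)))
    red-x : ∀ {h} → HostEdge h red (u 0) (u (suc lo)) → HostEdge h red (u 0) (emb (odd (lo + D))) →
            Cycle (HostEdge h red) (K (suc b))
    red-x {h} hi x = subst (Cycle (HostEdge h red)) 2+2t≡K
      (redApexCycle (2 * suc lo) (suc (2 * suc b)) 0 (s≤s z≤n)
         (subst Position (sym (shift b e)) (w-position x<m))
         (s≤s z≤n) (inj₁ (s≤s z≤n))
         (subst (λ p → HostEdge h red (emb p) (u 0)) (sym (shift b e)) (hostEdge-sym x)) hi)
      where
      shift : ∀ b e → 2 * suc (2 + b + e) + suc (2 * suc b) ≡ suc (2 * (2 + b + e + (2 + b)))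
      shift = solve-∀
    red-yx : ∀ {h} → HostEdge h red (emb (odd lo)) (emb (odd (lo + D))) → Cycle (HostEdge h red) (K (suc b))
    red-yx {h} yx = redChordCycle (odd lo) (2 * D) (*-monoʳ-≤ 2 {1} {D} (s≤s z≤n))
                      (subst Position (sym (shift b e)) (w-position x<m))
                      (subst (λ p → HostEdge h red (emb p) (emb (odd lo))) (sym (shift b e)) (hostEdge-sym yx))
      where
      shift : ∀ b e → suc (2 * (2 + b + e)) + 2 * (2 + b) ≡ suc (2 * (2 + b + e + (2 + b)))
      shift = solve-∀
    red-yz : ∀ {h} → HostEdge h red (emb (odd lo)) (u z) → HostEdge h red (u (suc e)) (u z) →
             Cycle (HostEdge h red) (K (suc b))
    red-yz {h} yz cz = subst (Cycle (HostEdge h red)) 2+2t≡K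
      (redApexCycle (2 * suc e) (suc (2 * suc b)) (2 * z) (s≤s z≤n)
         (subst Position (sym (shift b e)) (w-position (≤-trans (m<m+n lo (s≤s z≤n)) (≤-trans lo+2≤z z≤m))))
         (u-position z≤m)
         (inj₂ (subst (_≤ 2 * z) (shift′ b e) (*-monoʳ-≤ 2 (≤-trans (m<m+n lo (s≤s z≤n)) lo+2≤z))))
         (subst (λ p → HostEdge h red (emb p) (u z)) (sym (shift b e)) yz) (hostEdge-sym cz))
      where
      shift : ∀ b e → 2 * suc e + suc (2 * suc b) ≡ suc (2 * (2 + b + e))
      shift = solve-∀
      shift′ : ∀ b e → 2 * suc (2 + b + e) ≡ suc (2 * suc e + suc (2 * suc b))
      shift′ = solve-∀

  geometry : ∀ a e → 2 + a + e ≤ z → suc a + e ≡ 1 ⊎ K a + (suc a + e) < m → EndgameGeometry a e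
  geometry zero    e hi≤z _           = geometry₀ e hi≤z
  geometry (suc b) e _    (inj₂ room) = geometry₊ b e room

  cIdx-start : ∀ a e → suc a + e ≡ 1 → cIdx a e ≡ 0
  cIdx-start zero zero refl = refl

  OutsideGap : ℕ → ℕ → Edge → Set
  OutsideGap lo hi (x , y) = x ≡ u 0 × Σ ℕ λ j → y ≡ u j × j ≤ m × (j ≤ lo ⊎ hi ≤ j)

  FromU0 : Edge → Set
  FromU0 (x , _) = x ≡ u 0

  halving-budget : ∀ t x g → 2 * x ≤ suc g → 2 ^ t * suc g ≤ 4 * m → 2 ^ suc t * x ≤ 4 * m
  halving-budget t x g 2x≤ budget = begin
    2 ^ suc t * x    ≡⟨ regroup (2 ^ t) x ⟩
    2 ^ t * (2 * x)  ≤⟨ *-monoʳ-≤ (2 ^ t) 2x≤ ⟩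
    2 ^ t * suc g    ≤⟨ budget ⟩
    4 * m            ∎
    where
    open ≤-Reasoning
    regroup : ∀ p x → 2 * p * x ≡ p * (2 * x)
    regroup = solve-∀

  doubling-budget : ∀ t g → 2 ^ t * suc g ≤ 4 * m → 2 ^ suc t ≤ 8 * m
  doubling-budget t g budget = begin
    2 * 2 ^ t        ≤⟨ *-monoʳ-≤ 2 (≤-trans (m≤m*n (2 ^ t) (suc g)) budget) ⟩
    2 * (4 * m)      ≡⟨ sym (*-assoc 2 4 m) ⟩
    8 * m            ∎
    where open ≤-Reasoning

  within : ∀ t r → r ≤ 3 + t → 2 ^ t ≤ 8 * m → FewerThanLog2Plus8 m r
  within t r r≤ budget = begin-strict
    2 ^ r                 ≤⟨ ^-monoʳ-≤ 2 r≤ ⟩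
    2 ^ (3 + t)           ≡⟨ regroup (2 ^ t) ⟩
    8 * 2 ^ t             ≤⟨ *-monoʳ-≤ 8 budget ⟩
    8 * (8 * m)           ≡⟨ sym (*-assoc 8 8 m) ⟩
    64 * m                <⟨ *-monoˡ-< m (m≤m+n 65 191) ⟩
    256 * m               ∎
    where
    open ≤-Reasoning
    regroup : ∀ p → 2 * (2 * (2 * p)) ≡ 8 * p
    regroup = solve-∀

  module Play (a : ℕ) (k<m : K a < m) (π : PainterStrategy) where
    β : BuilderStrategy
    β = builder a

    H : ℕ → History
    H = play β π

    phase : ℕ → Phase
    phase t = phaseAfter a (H t)

    answer : ℕ → Color
    answer t = π (H t) (β (H t))

    LegalUpTo : ℕ → Set
    LegalUpTo t = ∀ r → r < t → Legal (H r) (β (H r))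

    Outcome : Set
    Outcome = Σ ℕ λ r → FewerThanLog2Plus8 m r × LegalUpTo r × Goal.Target emb m (K a) (H r)

    legalUpTo-suc : ∀ {t} → LegalUpTo t → Legal (H t) (β (H t)) → LegalUpTo (suc t)
    legalUpTo-suc L l r r≤t with m≤n⇒m<n∨m≡n (≤-pred r≤t)
    ... | inj₁ r<t  = L r r<t
    ... | inj₂ refl = l

    recorded : ∀ {t x y c} → β (H t) ≡ (x , y) → answer t ≡ c → ((x , y) , c) ∈ H (suc t)
    recorded refl refl = here refl

    answered : ∀ {t x y c} → β (H t) ≡ (x , y) → answer t ≡ c → HostEdge (H (suc t)) c x y
    answered q c = inj₂ (inj₁ (recorded q c))

    winRed : ∀ r → FewerThanLog2Plus8 m r → LegalUpTo r → Cycle (HostEdge (H r) red) (K a) → Outcome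
    winRed r fast L C = r , fast , L , inj₁ C

    winBlue : ∀ r → FewerThanLog2Plus8 m r → LegalUpTo r → LongBlue a (H r) → Outcome
    winBlue r fast L (ℓ , (C , inTail , first) , long , short) =
      r , fast , L , inj₂ (ℓ , C , inTail , long , short , first)

    early : ∀ r → r ≤ 3 → FewerThanLog2Plus8 m r
    early r r≤3 = within 0 r r≤3 (≤-trans (s≤s z≤n) (m≤m*n 8 m))

    3≤K : 3 ≤ K a
    3≤K = s≤s (*-monoʳ-≤ 2 (s≤s z≤n))

    2≤z : 2 ≤ z
    2≤z = ≤-pred (≤-pred (≤-trans (s≤s 3≤K) k<m))

    record Bisecting (t e g : ℕ) : Set where
      field
        at-phase     : phase t ≡ bisect e g
        gap≥1        : 1 ≤ g
        hi≤z         : suc a + e + g ≤ z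
        queried      : AllQueries (OutsideGap (suc a + e) (suc a + e + g)) (H t)
        red-hi       : HostEdge (H t) red (u 0) (u (suc a + e + g))
        blue-lo      : HostEdge (H t) blue (u (suc a + e)) (u 0)
        -- lo = 1 before any blue answer; after one, K a + lo ≥ m would make u₀…u_lo a long blue cycle
        room         : suc a + e ≡ 1 ⊎ K a + (suc a + e) < m
        red-z        : HostEdge (H t) red (u 0) (u z)
        legal-so-far : LegalUpTo t
        budget       : 2 ^ t ≤ 8 * m
        budget-gap   : 2 ^ t * (g ∸ 1) ≤ 4 * m

    module Halving {t e g} (B : Bisecting t e (2 + g)) where
      open Bisecting B

      lo mid hi : ℕ
      lo  = suc a + e
      mid = lo + ⌊ 2 + g /2⌋
      hi  = lo + (2 + g)

      lo<mid : lo < mid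
      lo<mid = m<m+n lo (s≤s z≤n)

      mid<hi : mid < hi
      mid<hi = +-monoʳ-< lo (s≤s (s≤s (⌊n/2⌋≤n g)))

      mid≤m : mid ≤ m
      mid≤m = ≤-trans (<⇒≤ mid<hi) (≤-trans hi≤z z≤m)

      2≤mid : 2 ≤ mid
      2≤mid = ≤-trans (s≤s (s≤s z≤n)) lo<mid

      probe : β (H t) ≡ (u 0 , u mid)
      probe = cong (query a) at-phase

      probe-legal : Legal (H t) (β (H t))
      probe-legal = subst (Legal (H t)) (sym probe) (legal-u₀u 2≤mid mid≤m
        (λ c → unqueried queried λ { (_ , j , mid≡j , j≤m , side) → off-gap side (u-injective mid≤m j≤m mid≡j) })
        (λ c → unqueried queried λ { (mid≡0 , _) → u≢u₀ (≤-trans (s≤s z≤n) 2≤mid) mid≤m mid≡0 }))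
        where
        off-gap : ∀ {j} → j ≤ lo ⊎ hi ≤ j → mid ≢ j
        off-gap (inj₁ j≤lo) refl = <⇒≱ lo<mid j≤lo
        off-gap (inj₂ hi≤j) refl = <⇒≱ mid<hi hi≤j

      legal-now : LegalUpTo (suc t)
      legal-now = legalUpTo-suc legal-so-far probe-legal

      Next : Set
      Next = Outcome ⊎ Σ ℕ λ e′ → Σ ℕ λ g′ → g′ ≤ suc g × Bisecting (suc t) e′ g′

      after-red : answer t ≡ red → Bisecting (suc t) e ⌊ 2 + g /2⌋
      after-red said = record
        { at-phase     = cong₂ (step a) at-phase said
        ; gap≥1        = s≤s z≤n
        ; hi≤z         = ≤-trans (<⇒≤ mid<hi) hi≤z
        ; queried      = subst (OutsideGap lo mid) (sym probe) (refl , mid , refl , mid≤m , inj₂ ≤-refl)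
                         ∷ All.map narrow queried
        ; red-hi       = answered probe said
        ; blue-lo      = earlier _ blue-lo
        ; room         = room
        ; red-z        = earlier _ red-z
        ; legal-so-far = legal-now
        ; budget       = doubling-budget t g budget-gap
        ; budget-gap   = halving-budget t ⌊ g /2⌋ g (≤-trans (2*⌊n/2⌋≤n g) (n≤1+n g)) budget-gap
        }
        where
        narrow : ∀ {q} → OutsideGap lo hi q → OutsideGap lo mid q
        narrow {_ , _} (u0 , j , eq , j≤m , inj₁ j≤lo) = u0 , j , eq , j≤m , inj₁ j≤lo
        narrow {_ , _} (u0 , j , eq , j≤m , inj₂ hi≤j) = u0 , j , eq , j≤m , inj₂ (≤-trans (<⇒≤ mid<hi) hi≤j)

      after-blue : answer t ≡ blue → K a + mid < m → Bisecting (suc t) (e + ⌊ 2 + g /2⌋) ⌈ 2 + g /2⌉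
      after-blue said roomy = record
        { at-phase     = cong₂ (step a) at-phase said
        ; gap≥1        = s≤s z≤n
        ; hi≤z         = subst (_≤ z) (sym hi′≡hi) hi≤z
        ; queried      = subst₂ (λ l h → AllQueries (OutsideGap l h) (H (suc t))) (sym lo′≡mid) (sym hi′≡hi)
                           (subst (OutsideGap mid hi) (sym probe) (refl , mid , refl , mid≤m , inj₁ ≤-refl)
                            ∷ All.map narrow queried)
        ; red-hi       = subst (λ i → HostEdge (H (suc t)) red (u 0) (u i)) (sym hi′≡hi) (earlier _ red-hi)
        ; blue-lo      = subst (λ i → HostEdge (H (suc t)) blue (u i) (u 0)) (sym lo′≡mid)
                           (hostEdge-sym (answered probe said))
        ; room         = inj₂ (subst (λ i → K a + i < m) (sym lo′≡mid) roomy)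
        ; red-z        = earlier _ red-z
        ; legal-so-far = legal-now
        ; budget       = doubling-budget t g budget-gap
        ; budget-gap   = halving-budget t ⌈ g /2⌉ g (2*⌊n/2⌋≤n (suc g)) budget-gap
        }
        where
        lo′≡mid : suc a + (e + ⌊ 2 + g /2⌋) ≡ mid
        lo′≡mid = sym (+-assoc (suc a) e ⌊ 2 + g /2⌋)
        hi′≡hi : suc a + (e + ⌊ 2 + g /2⌋) + ⌈ 2 + g /2⌉ ≡ hi
        hi′≡hi = begin
          suc a + (e + ⌊ 2 + g /2⌋) + ⌈ 2 + g /2⌉  ≡⟨ cong (_+ ⌈ 2 + g /2⌉) lo′≡mid ⟩
          lo + ⌊ 2 + g /2⌋ + ⌈ 2 + g /2⌉           ≡⟨ +-assoc lo ⌊ 2 + g /2⌋ ⌈ 2 + g /2⌉ ⟩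
          lo + (⌊ 2 + g /2⌋ + ⌈ 2 + g /2⌉)         ≡⟨ cong (lo +_) (⌊n/2⌋+⌈n/2⌉≡n (2 + g)) ⟩
          hi                                        ∎
          where open ≡-Reasoning
        narrow : ∀ {q} → OutsideGap lo hi q → OutsideGap mid hi q
        narrow {_ , _} (u0 , j , eq , j≤m , inj₁ j≤lo) = u0 , j , eq , j≤m , inj₁ (≤-trans j≤lo (<⇒≤ lo<mid))
        narrow {_ , _} (u0 , j , eq , j≤m , inj₂ hi≤j) = u0 , j , eq , j≤m , inj₂ hi≤j

      next : Next
      next with answer t in said
      ... | red  = inj₂ (e , ⌊ 2 + g /2⌋ , s≤s (⌊n/2⌋≤n g) , after-red said)
      ... | blue with m ≤? K a + mid
      ...   | yes short = inj₁ (winBlue (suc t) (within t (suc t) (m≤n+m (suc t) 2) budget) legal-now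
                                 (suc mid , blueChordCycle mid 2≤mid mid≤m (hostEdge-sym (answered probe said)) ,
                                  s≤s (m≤n+o⇒m∸n≤o m (K a) short) , s≤s mid≤m))
      ...   | no roomy  = inj₂ (e + ⌊ 2 + g /2⌋ , ⌈ 2 + g /2⌉ , s≤s (⌈n/2⌉≤n g) , after-blue said (≰⇒> roomy))

    module Endgame {t e} (B : Bisecting t e 1) where
      open Bisecting B

      lo : ℕ
      lo = suc a + e

      hi≡ : lo + 1 ≡ suc lo
      hi≡ = +-comm lo 1

      open EndgameGeometry (geometry a e (subst (_≤ z) hi≡ hi≤z) room)

      X Y : ℕ
      X = odd (xIdx a e)
      Y = odd (yIdx a e)

      X-pos : Position X
      X-pos = w-position x<m

      Y-pos : Position Y
      Y-pos = w-position (≤-trans (m<m+n _ (s≤s z≤n)) (≤-trans y+2≤z z≤m))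

      z-pos : Position (2 * z)
      z-pos = u-position z≤m

      odd≢u : ∀ i {j} → Position (odd i) → j ≤ m → emb (odd i) ≢ u j
      odd≢u i {j} pos j≤m eq = even≢odd j i (sym (emb-injective pos (u-position j≤m) eq))

      uz≢u0 : u z ≢ u 0
      uz≢u0 = u≢u₀ (≤-trans (s≤s z≤n) 2≤z) z≤m

      fast : ∀ r → r ≤ 3 + t → FewerThanLog2Plus8 m r
      fast r r≤ = within t r r≤ budget

      probe₁ : β (H t) ≡ (u 0 , emb X)
      probe₁ = cong (query a) at-phase

      legal₁ : LegalUpTo (suc t)
      legal₁ = legalUpTo-suc legal-so-far (subst (Legal (H t)) (sym probe₁)
        (legal (u-position z≤n) X-pos (λ ())
               (far⇒¬tailAdjacent (s≤s (*-monoʳ-≤ 2 x≥1)))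
               (λ c → unqueried queried λ { (_ , j , X≡j , j≤m , _) → odd≢u (xIdx a e) X-pos j≤m X≡j })
               (λ c → unqueried queried λ { (X≡0 , _) → odd≢u (xIdx a e) X-pos z≤n X≡0 })))

      from-u0 : AllQueries FromU0 (H (suc t))
      from-u0 = subst FromU0 (sym probe₁) refl ∷ All.map from-u0-of queried
        where
        from-u0-of : ∀ {q} → OutsideGap lo (lo + 1) q → FromU0 q
        from-u0-of {_ , _} (u0 , _) = u0

      module AfterBlue₁ (said₁ : answer t ≡ blue) where
        probe₂ : β (H (suc t)) ≡ (emb Y , u z)
        probe₂ = cong (query a) (cong₂ (step a) at-phase said₁)

        legal₂ : LegalUpTo (2 + t)
        legal₂ = legalUpTo-suc legal₁ (subst (Legal (H (suc t))) (sym probe₂)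
          (legal Y-pos z-pos (λ Y≡ → even≢odd z (yIdx a e) (sym Y≡))
                 (far⇒¬tailAdjacent (subst (_≤ 2 * z) (sym (shift (yIdx a e))) (*-monoʳ-≤ 2 y+2≤z)))
                 (λ c → unqueried from-u0 (odd≢u (yIdx a e) Y-pos z≤n))
                 (λ c → unqueried from-u0 uz≢u0)))
          where
          shift : ∀ y → 3 + suc (2 * y) ≡ 2 * (y + 2)
          shift = solve-∀

        Seen : Edge → Set
        Seen q = FromU0 q ⊎ q ≡ (emb Y , u z)

        seen : AllQueries Seen (H (2 + t))
        seen = subst Seen (sym probe₂) (inj₂ refl) ∷ All.map inj₁ from-u0

        afterBlue₂ : answer (suc t) ≡ blue → Outcome
        afterBlue₂ said₂ = decide (answer (2 + t)) refl
          where
          probe₃ : β (H (2 + t)) ≡ (emb Y , emb X)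
          probe₃ = cong (query a) (cong₂ (step a) (cong₂ (step a) at-phase said₁) said₂)
          legal₃ : LegalUpTo (3 + t)
          legal₃ = legalUpTo-suc legal₂ (subst (Legal (H (2 + t))) (sym probe₃)
            (legal Y-pos X-pos (λ Y≡X → y≢x (2*-injective (suc-injective Y≡X)))
                   (odd⇒¬tailAdjacent (yIdx a e) (xIdx a e))
                   (λ c → unqueried seen λ { (inj₁ Y≡0) → odd≢u (yIdx a e) Y-pos z≤n Y≡0
                                            ; (inj₂ eq) → odd≢u (xIdx a e) X-pos z≤m (cong proj₂ eq) })
                   (λ c → unqueried seen λ { (inj₁ X≡0) → odd≢u (xIdx a e) X-pos z≤n X≡0
                                            ; (inj₂ eq) → y≢x (2*-injective (suc-injective
                                                (emb-injective Y-pos X-pos (sym (cong proj₁ eq))))) })))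
          decide : ∀ c → answer (2 + t) ≡ c → Outcome
          decide red  said₃ = winRed (3 + t) (fast (3 + t) ≤-refl) legal₃ (red-yx (answered probe₃ said₃))
          decide blue said₃ = winBlue (3 + t) (fast (3 + t) ≤-refl) legal₃
                                (blue-yx (earlier _ (answered probe₂ said₂)) (answered probe₃ said₃)
                                         (earlier _ (earlier _ (answered probe₁ said₁))))

        afterRed₂ : answer (suc t) ≡ red → lo ≢ 1 → Outcome
        afterRed₂ said₂ lo≢1 = decide (answer (2 + t)) refl
          where
          c : ℕ
          c = cIdx a e
          c≤z : c ≤ z
          c≤z = ≤-trans (m≤m+n c 2) c+2≤z
          probe₃ : β (H (2 + t)) ≡ (u c , u z)
          probe₃ = cong (query a) (cong₂ (step a) (cong₂ (step a) at-phase said₁) said₂)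
          legal₃ : LegalUpTo (3 + t)
          legal₃ = legalUpTo-suc legal₂ (subst (Legal (H (2 + t))) (sym probe₃)
            (legal (u-position (≤-trans c≤z z≤m)) z-pos
                   (λ c≡z → <⇒≢ (≤-trans (m<m+n c (s≤s z≤n)) c+2≤z) (2*-injective c≡z))
                   (far⇒¬tailAdjacent (≤-trans (n≤1+n _) (subst (_≤ 2 * z) (sym (shift c)) (*-monoʳ-≤ 2 c+2≤z))))
                   (λ col → unqueried seen λ { (inj₁ c≡0) → u≢u₀ (c≥1 lo≢1) (≤-trans c≤z z≤m) c≡0
                                              ; (inj₂ eq) → odd≢u (yIdx a e) Y-pos (≤-trans c≤z z≤m)
                                                                  (sym (cong proj₁ eq)) })
                   (λ col → unqueried seen λ { (inj₁ z≡0) → uz≢u0 z≡0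
                                              ; (inj₂ eq) → odd≢u (yIdx a e) Y-pos z≤m (sym (cong proj₁ eq)) })))
            where
            shift : ∀ c → 4 + 2 * c ≡ 2 * (c + 2)
            shift = solve-∀
          decide : ∀ col → answer (2 + t) ≡ col → Outcome
          decide red  said₃ = winRed (3 + t) (fast (3 + t) ≤-refl) legal₃
                                (red-yz (earlier _ (answered probe₂ said₂)) (answered probe₃ said₃))
          decide blue said₃ = winBlue (3 + t) (fast (3 + t) ≤-refl) legal₃
                                (blue-cz lo≢1 (answered probe₃ said₃) (earlier _ (earlier _ (earlier _ blue-lo))))

        afterBlue₁ : Outcome
        afterBlue₁ = decide (answer (suc t)) refl
          where
          decide : ∀ c → answer (suc t) ≡ c → Outcome
          decide red said₂ with lo ≟ 1
          ... | yes lo≡1 = winRed (2 + t) (fast (2 + t) (m≤n+m (2 + t) 1)) legal₂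
                             (red-yz (answered probe₂ said₂)
                                     (subst (λ i → HostEdge (H (2 + t)) red (u i) (u z)) (sym (cIdx-start a e lo≡1))
                                            (earlier _ (earlier _ red-z))))
          ... | no lo≢1  = afterRed₂ said₂ lo≢1
          decide blue said₂ = afterBlue₂ said₂

      outcome : Outcome
      outcome = decide (answer t) refl
        where
        decide : ∀ c → answer t ≡ c → Outcome
        decide red said₁ =
          winRed (suc t) (fast (suc t) (m≤n+m (suc t) 2)) legal₁
            (red-x (subst (λ i → HostEdge (H (suc t)) red (u 0) (u i)) hi≡ (earlier _ red-hi))
                   (answered probe₁ said₁))
        decide blue said₁ = AfterBlue₁.afterBlue₁ said₁

    bisection : ∀ n {t e g} → g ≤ n → Bisecting t e g → Outcome
    bisection _       {g = zero}          _   B = ⊥-elim (1+n≰n (Bisecting.gap≥1 B))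
    bisection _       {g = suc zero}      _   B = Endgame.outcome B
    bisection (suc n) {g = suc (suc g)} g≤n B with Halving.next B
    ... | inj₁ done                   = done
    ... | inj₂ (_ , _ , g′≤1+g , B′) = bisection n (≤-trans g′≤1+g (≤-pred g≤n)) B′

    StartsBisection : Set
    StartsBisection = Σ ℕ λ t → Σ ℕ λ g → g ≤ z × Bisecting t 0 g

    1+a<z : suc a < z
    1+a<z = ≤-trans (subst (2 + a ≤_) (sym (*-suc 2 a)) (s≤s (s≤s (m≤n*m a 2)))) (≤-pred (≤-pred k<m))

    startBisection : ∀ t → t ≤ 2 → phase t ≡ bisect 0 (z ∸ suc a) → AllQueries (OutsideGap (suc a) z) (H t) →
            HostEdge (H t) red (u 0) (u z) → HostEdge (H t) blue (u (suc a)) (u 0) →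
            suc a ≡ 1 ⊎ K a + suc a < m → LegalUpTo t → StartsBisection
    startBisection t t≤2 at queried red-z blue-lo room L = t , g , m∸n≤m z (suc a) , record
      { at-phase     = at
      ; gap≥1        = m<n⇒0<n∸m 1+a<z
      ; hi≤z         = ≤-reflexive hi≡z
      ; queried      = subst₂ (λ l h → AllQueries (OutsideGap l h) (H t)) (sym lo≡) (sym hi≡z) queried
      ; red-hi       = subst (λ i → HostEdge (H t) red (u 0) (u i)) (sym hi≡z) red-z
      ; blue-lo      = subst (λ i → HostEdge (H t) blue (u i) (u 0)) (sym lo≡) blue-lo
      ; room         = subst (λ i → i ≡ 1 ⊎ K a + i < m) (sym lo≡) room
      ; red-z        = red-z
      ; legal-so-far = L
      ; budget       = ≤-trans 2^t≤4 (≤-trans (m≤m+n 4 4) (m≤m*n 8 m))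
      ; budget-gap   = *-mono-≤ 2^t≤4 (≤-trans (m∸n≤m g 1) (≤-trans (m∸n≤m z (suc a)) z≤m))
      }
      where
      g : ℕ
      g = z ∸ suc a
      lo≡ : suc a + 0 ≡ suc a
      lo≡ = +-identityʳ (suc a)
      hi≡z : suc a + 0 + g ≡ z
      hi≡z = trans (cong (_+ g) lo≡) (m+[n∸m]≡n (<⇒≤ 1+a<z))
      2^t≤4 : 2 ^ t ≤ 4
      2^t≤4 = ^-monoʳ-≤ 2 t≤2

    legal₀ : LegalUpTo 1
    legal₀ = legalUpTo-suc (λ _ ()) (legal-u₀u 2≤z z≤m (λ _ ()) (λ _ ()))

    module SecondRound (said₀ : answer 0 ≡ red) (at₁ : phase 1 ≡ second) (a≥1 : 1 ≤ a) where
      probe : β (H 1) ≡ (u 0 , u (suc a))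
      probe = cong (query a) at₁

      1+a≤m : suc a ≤ m
      1+a≤m = ≤-trans (<⇒≤ 1+a<z) z≤m

      legal₁ : LegalUpTo 2
      legal₁ = legalUpTo-suc legal₀ (subst (Legal (H 1)) (sym probe) (legal-u₀u (s≤s a≥1) 1+a≤m
        (λ { _ (here eq) → <⇒≢ 1+a<z (u-injective 1+a≤m z≤m (cong (proj₂ ∘ proj₁) eq)) ; _ (there ()) })
        (λ { _ (here eq) → u≢u₀ (s≤s z≤n) 1+a≤m (cong (proj₁ ∘ proj₁) eq) ; _ (there ()) })))

      outcome : Outcome ⊎ StartsBisection
      outcome with answer 1 in said₁
      ... | red = inj₁ (winRed 2 (early 2 (s≤s (s≤s z≤n))) legal₁
                          (redChordCycle 0 (2 * suc a) (*-monoʳ-≤ 2 (s≤s z≤n)) (u-position 1+a≤m)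
                             (hostEdge-sym (answered probe said₁))))
      ... | blue with m ≤? K a + suc a
      ...   | yes short = inj₁ (winBlue 2 (early 2 (s≤s (s≤s z≤n))) legal₁
                                 (2 + a , blueChordCycle (suc a) (s≤s a≥1) 1+a≤m (hostEdge-sym (answered probe said₁)) ,
                                  s≤s (m≤n+o⇒m∸n≤o m (K a) short) , s≤s 1+a≤m))
      ...   | no roomy  = inj₂ (startBisection 2 ≤-refl (cong₂ (step a) at₁ said₁)
                                  (subst (OutsideGap (suc a) z) (sym probe) (refl , suc a , refl , 1+a≤m , inj₁ ≤-refl) ∷
                                   (refl , z , refl , z≤m , inj₂ ≤-refl) ∷ [])
                                  (earlier _ (answered refl said₀)) (hostEdge-sym (answered probe said₁))
                                  (inj₂ (≰⇒> roomy)) legal₁)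

    openingRounds : Outcome ⊎ StartsBisection
    openingRounds with answer 0 in said₀
    ... | blue = inj₁ (winBlue 1 (early 1 (s≤s z≤n)) legal₀
                         (suc z , blueChordCycle z 2≤z z≤m (hostEdge-sym (answered refl said₀)) ,
                          s≤s (≤-trans (∸-monoʳ-≤ m 3≤K) (m∸n≤m z 1)) , s≤s z≤m))
    ... | red = byShape a refl
      where
      at₁ : phase 1 ≡ afterOpening a
      at₁ = cong (step a opening) said₀
      byShape : ∀ a′ → a ≡ a′ → Outcome ⊎ StartsBisection
      byShape zero a≡0 = inj₂ (startBisection 1 (s≤s z≤n)
        (trans at₁ (subst (λ x → afterOpening x ≡ bisect 0 (z ∸ suc x)) (sym a≡0) refl))
        ((refl , z , refl , z≤m , inj₂ ≤-refl) ∷ [])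
        (answered refl said₀)
        (subst (λ x → HostEdge (H 1) blue (u (suc x)) (u 0)) (sym a≡0)
               (inj₁ (0 , s≤s z≤n , inj₂ (refl , refl))))
        (inj₁ (cong suc a≡0)) legal₀)
      byShape (suc b) a≡1+b =
        SecondRound.outcome said₀ (trans at₁ (cong afterOpening a≡1+b))
                              (subst (1 ≤_) (sym a≡1+b) (s≤s z≤n))

    result : Outcome
    result with openingRounds
    ... | inj₁ done               = done
    ... | inj₂ (_ , _ , g≤z , B) = bisection z g≤z B

oddDecomposition : ∀ k → Odd k → 3 ≤ k → Σ ℕ λ a → k ≡ suc (2 * suc a)
oddDecomposition k k-odd 3≤k = halve (k / 2) (trans (m≡m%n+[m/n]*n k 2) (cong (_+ k / 2 * 2) k-odd))
  where
  halve : ∀ q → k ≡ 1 + q * 2 → Σ ℕ λ a → k ≡ suc (2 * suc a)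
  halve zero    k≡1 = ⊥-elim (<⇒≱ (s≤s (s≤s z≤n)) (subst (3 ≤_) k≡1 3≤k))
  halve (suc a) k≡  = a , trans k≡ (cong suc (*-comm (suc a) 2))

lemma18 : (k n m : ℕ) → 3 ≤ k → Odd k → k < m →
    (emb : ℕ → ℕ) → InjectiveBelow (1 + 2 * m) emb →
    Σ BuilderStrategy λ β → (π : PainterStrategy) →
      Σ ℕ λ r → FewerThanLog2Plus8 m r ×
        ((r′ : ℕ) → r′ < r → Host.Legal emb m (play β π r′) (β (play β π r′))) ×
        Goal.Target emb m k (play β π r)
lemma18 k n (suc (suc z)) 3≤k k-odd k<m emb emb-inj with oddDecomposition k k-odd 3≤k
... | a , refl = Strategy.builder z emb emb-inj a , Strategy.Play.result z emb emb-inj a k<m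
lemma18 k n 1 3≤k _ k<1 = ⊥-elim (<⇒≱ k<1 (≤-trans (s≤s z≤n) 3≤k))
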